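{- Let $t$ be a positive integer and let $p(x_1,\ldots,x_t)$ be a polynomial with integer coefficients. Then there effectively exist (i.e. can be computed from $p$) a positive integer $k$ and matrices $A,M,N,B\in\mathbb{Z}^{k\times k}_{\rm uptr}$ such that \[AM^{a_1}NM^{a_2}N\cdots NM^{a_t}B=p(a_1,\ldots,a_t)E_k\] for all $a_1,\ldots,a_t\in\mathbb{N}$.
   Context: $\mathbb{Z}^{k\times k}_{\rm uptr}$ is the set of upper-triangular $k\times k$ integer matrices. $E_k$ is the $k\times k$ matrix whose only nonzero entry is the entry in row $1$, column $k$, which equals $1$ (so $p(a_1,\ldots,a_t)E_k$ is the matrix whose only possibly nonzero entry is $p(a_1,\ldots,a_t)$ in row $1$, column $k$). $\mathbb{N}$ is the set of nonnegative integers and $M^0$ is the identity matrix. -}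

module Defs where

open import Data.Nat as ℕ using (ℕ; zero; suc)
open import Data.Integer as ℤ using (ℤ; +_)
open import Data.Fin as Fin using (Fin; toℕ)
open import Data.Vec using (Vec; []; _∷_; lookup)
open import Data.Bool using (if_then_else_; _∧_)
open import Relation.Binary.PropositionalEquality using (_≡_)
open import Relation.Nullary.Decidable using (⌊_⌋)

-- Polynomials in t variables x₀ … x_{t-1} with integer coefficients,
-- represented as (formal) expressions: every element of ℤ[x₁,…,x_t]
-- is the value of such an expression and vice versa.
data Poly (t : ℕ) : Set where
  con  : ℤ → Poly t
  var  : Fin t → Poly t
  _⊕_  : Poly t → Poly t → Poly t
  _⊗_  : Poly t → Poly t → Poly t

eval : ∀ {t} → Poly t → Vec ℕ t → ℤ
eval (con c) a = c
eval (var i) a = + lookup a i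
eval (p ⊕ q) a = eval p a ℤ.+ eval q a
eval (p ⊗ q) a = eval p a ℤ.* eval q a

Mat : ℕ → Set
Mat k = Fin k → Fin k → ℤ

∑ : ∀ {k} → (Fin k → ℤ) → ℤ
∑ {zero}  f = + 0
∑ {suc k} f = f Fin.zero ℤ.+ ∑ (λ i → f (Fin.suc i))

_·_ : ∀ {k} → Mat k → Mat k → Mat k
(A · B) i j = ∑ (λ l → A i l ℤ.* B l j)

infixl 7 _·_

I : ∀ {k} → Mat k
I i j = if ⌊ i Fin.≟ j ⌋ then + 1 else + 0

_^_ : ∀ {k} → Mat k → ℕ → Mat k
M ^ zero  = I
M ^ suc n = M · (M ^ n)

UpperTriangular : ∀ {k} → Mat k → Set
UpperTriangular {k} A = ∀ (i j : Fin k) → j Fin.< i → A i j ≡ + 0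

E : (k : ℕ) → Mat k
E k i j = if ⌊ toℕ i ℕ.≟ 0 ⌋ ∧ ⌊ suc (toℕ j) ℕ.≟ k ⌋ then + 1 else + 0

_⋆_ : ∀ {k} → ℤ → Mat k → Mat k
(c ⋆ A) i j = c ℤ.* A i j

word : ∀ {k t} → Mat k → Mat k → Vec ℕ (suc t) → Mat k
word M N (a ∷ [])     = M ^ a
word M N (a ∷ b ∷ as) = (M ^ a) · N · word M N (b ∷ as)

module Submission where

-- Call a function f : ℕ^{t+1} → ℤ representable if there are k > 0,
-- upper-triangular M, N ∈ ℤ^{k×k} and vectors u, v ∈ ℤ^k with
--   uᵀ · M^{a₀} N M^{a₁} N ⋯ N M^{a_t} · v = f(a)   for all a.
-- Representable functions contain the constants (k = 1, M = N = 1) and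
-- the first coordinate a₀ (a 2×2 counter), are closed under dropping
-- the first coordinate (a block matrix that waits for the first N), and
-- under sums and products (block-diagonal sums and Kronecker products of
-- the matrices).  By induction on the expression, every polynomial is
-- representable; putting u in the first row of A and v in the last
-- column of B turns uᵀ W v into the corner entry of A W B.
--
-- All statements about words are reduced to one principle: a map φ on
-- row vectors that intertwines the right actions of (M, N) with those of
-- (M', N') intertwines the actions of corresponding words (`simulate`).

open import Defs
open import Data.Nat as ℕ using (ℕ; zero; suc; _<_; z≤n; s≤s)
import Data.Nat.Properties as ℕP
open import Data.Integer as ℤ using (ℤ; +_; _+_; _*_)
import Data.Integer.Properties as ℤP
open import Data.Integer.Tactic.RingSolver using (solve-∀)
open import Data.Fin as Fin
  using (Fin; toℕ; _↑ˡ_; _↑ʳ_; splitAt; combine; remQuot; quotient; remainder)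
import Data.Fin.Properties as FinP
open import Data.Vec using (Vec; []; _∷_; lookup; tail)
open import Data.Vec.Functional using (_++_; take; drop)
open import Data.Vec.Functional.Properties using (lookup-++ˡ; lookup-++ʳ; ++-cong)
open import Data.Bool using (Bool; true; false; if_then_else_; _∧_)
open import Data.Sum as Sum using (inj₁; inj₂)
open import Data.Product using (Σ; _×_; _,_)
open import Data.Empty using (⊥-elim)
open import Relation.Nullary using (yes; no)
open import Relation.Nullary.Decidable using (⌊_⌋)
open import Relation.Binary.PropositionalEquality
open import Function using (_∘_)

open ≡-Reasoning

∑-cong : ∀ {k} {f g : Fin k → ℤ} → f ≗ g → ∑ f ≡ ∑ g
∑-cong {zero}  e = refl
∑-cong {suc k} e = cong₂ _+_ (e Fin.zero) (∑-cong (e ∘ Fin.suc))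

∑-zero : ∀ {k} {f : Fin k → ℤ} → (∀ i → f i ≡ + 0) → ∑ f ≡ + 0
∑-zero {zero}  e = refl
∑-zero {suc k} e = cong₂ _+_ (e Fin.zero) (∑-zero (λ i → e (Fin.suc i)))

∑-+ : ∀ {k} (f g : Fin k → ℤ) → ∑ (λ i → f i + g i) ≡ ∑ f + ∑ g
∑-+ {zero}  f g = refl
∑-+ {suc k} f g =
  trans (cong (_+_ (f Fin.zero + g Fin.zero)) (∑-+ (f ∘ Fin.suc) (g ∘ Fin.suc)))
        (interchange (f Fin.zero) (g Fin.zero) _ _)
  where
  interchange : ∀ a b c d → a + b + (c + d) ≡ a + c + (b + d)
  interchange = solve-∀

∑-*ˡ : ∀ {k} (c : ℤ) (f : Fin k → ℤ) → ∑ (λ i → c * f i) ≡ c * ∑ f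
∑-*ˡ {zero}  c f = sym (ℤP.*-zeroʳ c)
∑-*ˡ {suc k} c f = trans (cong (_+_ (c * f Fin.zero)) (∑-*ˡ c (f ∘ Fin.suc)))
                         (sym (ℤP.*-distribˡ-+ c _ _))

∑-*ʳ : ∀ {k} (c : ℤ) (f : Fin k → ℤ) → ∑ (λ i → f i * c) ≡ ∑ f * c
∑-*ʳ c f = trans (∑-cong (λ i → ℤP.*-comm (f i) c)) (trans (∑-*ˡ c f) (ℤP.*-comm c _))

∑-swap : ∀ {m n} (f : Fin m → Fin n → ℤ) →
         ∑ (λ i → ∑ (λ j → f i j)) ≡ ∑ (λ j → ∑ (λ i → f i j))
∑-swap {zero} {n} f = sym (∑-zero {n} (λ _ → refl))
∑-swap {suc m}     f = trans (cong (_+_ (∑ (f Fin.zero))) (∑-swap (f ∘ Fin.suc)))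
                         (sym (∑-+ (f Fin.zero) _))

∑-split : ∀ m {n} (f : Fin (m ℕ.+ n) → ℤ) → ∑ f ≡ ∑ (take m f) + ∑ (drop m f)
∑-split zero    f = sym (ℤP.+-identityˡ _)
∑-split (suc m) f = trans (cong (_+_ (f Fin.zero)) (∑-split m (f ∘ Fin.suc)))
                          (sym (ℤP.+-assoc (f Fin.zero) _ _))

∑-combine : ∀ m n (f : Fin (m ℕ.* n) → ℤ) →
            ∑ f ≡ ∑ (λ i → ∑ (λ j → f (combine {m} {n} i j)))
∑-combine zero    n f = refl
∑-combine (suc m) n f =
  trans (∑-split n f) (cong (_+_ (∑ (take n f))) (∑-combine m n (drop n f)))

∑-remQuot : ∀ m n (F : Fin m × Fin n → ℤ) →
            ∑ (λ w → F (remQuot {m} n w)) ≡ ∑ (λ i → ∑ (λ j → F (i , j)))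
∑-remQuot m n F = trans (∑-combine m n (F ∘ remQuot {m} n))
  (∑-cong (λ i → ∑-cong (λ j → cong F (FinP.remQuot-combine i j))))

∑-product : ∀ {m n} (f : Fin m → ℤ) (g : Fin n → ℤ) →
            ∑ (λ i → ∑ (λ j → f i * g j)) ≡ ∑ f * ∑ g
∑-product f g = trans (∑-cong (λ i → ∑-*ˡ (f i) g)) (∑-*ʳ (∑ g) f)

Row : ℕ → Set
Row k = Fin k → ℤ

Rect : ℕ → ℕ → Set
Rect m n = Fin m → Fin n → ℤ

infixl 6 _▸_
_▸_ : ∀ {m n} → Row m → Rect m n → Row n
(x ▸ A) j = ∑ (λ i → x i * A i j)

dot : ∀ {k} → Row k → Row k → ℤ
dot x y = ∑ (λ i → x i * y i)

0ᵥ : ∀ {k} → Row k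
0ᵥ _ = + 0

0ₘ : ∀ {m n} → Rect m n
0ₘ _ _ = + 0

infixl 5 _+ᵥ_
_+ᵥ_ : ∀ {k} → Row k → Row k → Row k
(x +ᵥ y) i = x i + y i

▸-congˡ : ∀ {m n} {x y : Row m} (A : Rect m n) → x ≗ y → x ▸ A ≗ y ▸ A
▸-congˡ A e j = ∑-cong (λ i → cong (_* A i j) (e i))

▸-zeroˡ : ∀ {m n} (A : Rect m n) → 0ᵥ ▸ A ≗ 0ᵥ
▸-zeroˡ A j = ∑-zero (λ i → ℤP.*-zeroˡ (A i j))

▸-zeroʳ : ∀ {m n} (x : Row m) → x ▸ 0ₘ {m} {n} ≗ 0ᵥ
▸-zeroʳ x j = ∑-zero (λ i → ℤP.*-zeroʳ (x i))

dot-cong : ∀ {k} {x x' y y' : Row k} → x ≗ x' → y ≗ y' → dot x y ≡ dot x' y'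
dot-cong ex ey = ∑-cong (λ i → cong₂ _*_ (ex i) (ey i))

▸-assoc : ∀ {k} (x : Row k) (A B : Mat k) → x ▸ (A · B) ≗ (x ▸ A) ▸ B
▸-assoc x A B j = begin
  ∑ (λ i → x i * ∑ (λ l → A i l * B l j))
    ≡⟨ ∑-cong (λ i → sym (∑-*ˡ (x i) (λ l → A i l * B l j))) ⟩
  ∑ (λ i → ∑ (λ l → x i * (A i l * B l j)))
    ≡⟨ ∑-swap (λ i l → x i * (A i l * B l j)) ⟩
  ∑ (λ l → ∑ (λ i → x i * (A i l * B l j)))
    ≡⟨ ∑-cong (λ l → ∑-cong (λ i → sym (ℤP.*-assoc (x i) (A i l) (B l j)))) ⟩
  ∑ (λ l → ∑ (λ i → x i * A i l * B l j))
    ≡⟨ ∑-cong (λ l → ∑-*ʳ (B l j) (λ i → x i * A i l)) ⟩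
  ∑ (λ l → ∑ (λ i → x i * A i l) * B l j)
    ∎

-- I is compatible with Fin.suc (needed since Fin's _≟_ does not reduce
-- on variables).
I-suc : ∀ {k} (i j : Fin k) → I {suc k} (Fin.suc i) (Fin.suc j) ≡ I i j
I-suc i j with i Fin.≟ j
... | yes _ = refl
... | no  _ = refl

▸-I : ∀ {k} (x : Row k) → x ▸ I ≗ x
▸-I {suc k} x Fin.zero = begin
  x Fin.zero * + 1 + ∑ (λ i → x (Fin.suc i) * + 0)
    ≡⟨ cong (_+_ (x Fin.zero * + 1)) (∑-zero (λ i → ℤP.*-zeroʳ (x (Fin.suc i)))) ⟩
  x Fin.zero * + 1 + + 0
    ≡⟨ trans (ℤP.+-identityʳ _) (ℤP.*-identityʳ _) ⟩
  x Fin.zero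
    ∎
▸-I {suc k} x (Fin.suc j) = begin
  x Fin.zero * + 0 + ∑ (λ i → x (Fin.suc i) * I (Fin.suc i) (Fin.suc j))
    ≡⟨ cong₂ _+_ (ℤP.*-zeroʳ (x Fin.zero)) (∑-cong (λ i → cong (x (Fin.suc i) *_) (I-suc i j))) ⟩
  + 0 + ((x ∘ Fin.suc) ▸ I) j
    ≡⟨ ℤP.+-identityˡ _ ⟩
  ((x ∘ Fin.suc) ▸ I) j
    ≡⟨ ▸-I (x ∘ Fin.suc) j ⟩
  x (Fin.suc j)
    ∎

I-UT : ∀ {k} → UpperTriangular (I {k})
I-UT i j j<i with i Fin.≟ j
... | yes refl = ⊥-elim (ℕP.<-irrefl refl j<i)
... | no  _    = refl

▸-word-step : ∀ {k t} (M N : Mat k) (a b : ℕ) (as : Vec ℕ t) (x : Row k) →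
              x ▸ word M N (a ∷ b ∷ as) ≗ x ▸ M ^ a ▸ N ▸ word M N (b ∷ as)
▸-word-step {k} M N a b as x j = begin
  (x ▸ (M ^ a · N) · W) j    ≡⟨ ▸-assoc x (M ^ a · N) W j ⟩
  (x ▸ M ^ a · N ▸ W) j      ≡⟨ ▸-congˡ W (▸-assoc x (M ^ a) N) j ⟩
  (x ▸ M ^ a ▸ N ▸ W) j      ∎
  where
  W : Mat k
  W = word M N (b ∷ as)

record Simulation {m n} (M N : Mat m) (M' N' : Mat n) : Set where
  field
    φ      : Row m → Row n
    φ-cong : ∀ {x y} → x ≗ y → φ x ≗ φ y
    φ-M    : ∀ x → φ (x ▸ M) ≗ φ x ▸ M'
    φ-N    : ∀ x → φ (x ▸ N) ≗ φ x ▸ N'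
open Simulation

simulate-pow : ∀ {m n} {M N : Mat m} {M' N' : Mat n} (S : Simulation M N M' N') →
               ∀ a x → φ S (x ▸ M ^ a) ≗ φ S x ▸ M' ^ a
simulate-pow S zero x j = trans (φ-cong S (▸-I x) j) (sym (▸-I (φ S x) j))
simulate-pow {M = M} {M' = M'} S (suc a) x j = begin
  φ S (x ▸ M · M ^ a) j        ≡⟨ φ-cong S (▸-assoc x M (M ^ a)) j ⟩
  φ S (x ▸ M ▸ M ^ a) j        ≡⟨ simulate-pow S a (x ▸ M) j ⟩
  (φ S (x ▸ M) ▸ M' ^ a) j     ≡⟨ ▸-congˡ (M' ^ a) (φ-M S x) j ⟩
  (φ S x ▸ M' ▸ M' ^ a) j      ≡⟨ ▸-assoc (φ S x) M' (M' ^ a) j ⟨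
  (φ S x ▸ M' · M' ^ a) j      ∎

simulate : ∀ {m n t} {M N : Mat m} {M' N' : Mat n} (S : Simulation M N M' N') →
           (a : Vec ℕ (suc t)) (x : Row m) →
           φ S (x ▸ word M N a) ≗ φ S x ▸ word M' N' a
simulate S (a ∷ []) = simulate-pow S a
simulate {m} {n} {M = M} {N} {M'} {N'} S (a ∷ b ∷ as) x j = begin
  φ S (x ▸ word M N (a ∷ b ∷ as)) j      ≡⟨ φ-cong S (▸-word-step M N a b as x) j ⟩
  φ S (x ▸ M ^ a ▸ N ▸ W) j              ≡⟨ simulate S (b ∷ as) (x ▸ M ^ a ▸ N) j ⟩
  (φ S (x ▸ M ^ a ▸ N) ▸ W') j           ≡⟨ ▸-congˡ W' (λ l → trans (φ-N S (x ▸ M ^ a) l)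
                                                   (▸-congˡ N' (simulate-pow S a x) l)) j ⟩
  (φ S x ▸ M' ^ a ▸ N' ▸ W') j           ≡⟨ ▸-word-step M' N' a b as (φ S x) j ⟨
  (φ S x ▸ word M' N' (a ∷ b ∷ as)) j    ∎
  where
  W : Mat m
  W = word M N (b ∷ as)
  W' : Mat n
  W' = word M' N' (b ∷ as)

fixed-word : ∀ {k t} {M N : Mat k} (x : Row k) → x ▸ M ≗ x → x ▸ N ≗ x →
             (a : Vec ℕ (suc t)) → x ▸ word M N a ≗ x
fixed-word {M = M} {N} x fixM fixN a j = sym (simulate constant a x j)
  where
  constant : Simulation M N M N
  constant = record { φ = λ _ → x ; φ-cong = λ _ _ → refl
                    ; φ-M = λ _ l → sym (fixM l) ; φ-N = λ _ l → sym (fixN l) }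

-- Block upper-triangular matrices  ( P X )
--                                  ( 0 Q ),  built row by row.

module _ {m n : ℕ} where

  upper : Mat m → Rect m n → Fin m → Row (m ℕ.+ n)
  upper P X i = P i ++ X i

  lower : Mat n → Fin n → Row (m ℕ.+ n)
  lower Q i = 0ᵥ ++ Q i

  blk : Mat m → Rect m n → Mat n → Mat (m ℕ.+ n)
  blk P X Q = upper P X ++ lower Q

  module _ (P : Mat m) (X : Rect m n) (Q : Mat n) where

    blk-tl : ∀ i j → blk P X Q (i ↑ˡ n) (j ↑ˡ n) ≡ P i j
    blk-tl i j = trans (cong-app (lookup-++ˡ (upper P X) (lower Q) i) _) (lookup-++ˡ (P i) (X i) j)

    blk-tr : ∀ i j → blk P X Q (i ↑ˡ n) (m ↑ʳ j) ≡ X i j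
    blk-tr i j = trans (cong-app (lookup-++ˡ (upper P X) (lower Q) i) _) (lookup-++ʳ (P i) (X i) j)

    blk-bl : ∀ i j → blk P X Q (m ↑ʳ i) (j ↑ˡ n) ≡ + 0
    blk-bl i j = trans (cong-app (lookup-++ʳ (upper P X) (lower Q) i) _) (lookup-++ˡ (0ᵥ {m}) (Q i) j)

    blk-br : ∀ i j → blk P X Q (m ↑ʳ i) (m ↑ʳ j) ≡ Q i j
    blk-br i j = trans (cong-app (lookup-++ʳ (upper P X) (lower Q) i) _) (lookup-++ʳ (0ᵥ {m}) (Q i) j)

    take-▸-blk : ∀ z → take m (z ▸ blk P X Q) ≗ take m z ▸ P
    take-▸-blk z j = begin
      ∑ (λ w → z w * blk P X Q w (j ↑ˡ n))
        ≡⟨ ∑-split m _ ⟩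
      ∑ (λ i → z (i ↑ˡ n) * blk P X Q (i ↑ˡ n) (j ↑ˡ n))
        + ∑ (λ i → z (m ↑ʳ i) * blk P X Q (m ↑ʳ i) (j ↑ˡ n))
        ≡⟨ cong₂ _+_ (∑-cong (λ i → cong (z (i ↑ˡ n) *_) (blk-tl i j)))
                     (∑-zero (λ i → trans (cong (z (m ↑ʳ i) *_) (blk-bl i j))
                                          (ℤP.*-zeroʳ (z (m ↑ʳ i))))) ⟩
      (take m z ▸ P) j + + 0
        ≡⟨ ℤP.+-identityʳ _ ⟩
      (take m z ▸ P) j
        ∎

    drop-▸-blk : ∀ z → drop m (z ▸ blk P X Q) ≗ take m z ▸ X +ᵥ drop m z ▸ Q
    drop-▸-blk z j = trans (∑-split m _)
      (cong₂ _+_ (∑-cong (λ i → cong (z (i ↑ˡ n) *_) (blk-tr i j)))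
                 (∑-cong (λ i → cong (z (m ↑ʳ i) *_) (blk-br i j))))

  drop-▸-diag : (P : Mat m) (Q : Mat n) (z : Row (m ℕ.+ n)) →
                drop m (z ▸ blk P 0ₘ Q) ≗ drop m z ▸ Q
  drop-▸-diag P Q z j = trans (drop-▸-blk P 0ₘ Q z j)
    (trans (cong (_+ (drop m z ▸ Q) j) (▸-zeroʳ (take m z) j)) (ℤP.+-identityˡ _))

  take++drop : (z : Row (m ℕ.+ n)) → z ≗ take m z ++ drop m z
  take++drop z i with splitAt m i in eq
  ... | inj₁ j = cong z (sym (FinP.splitAt⁻¹-↑ˡ eq))
  ... | inj₂ j = cong z (sym (FinP.splitAt⁻¹-↑ʳ eq))

  ++-▸-blk : ∀ P X Q (x : Row m) (y : Row n) →
             (x ++ y) ▸ blk P X Q ≗ (x ▸ P) ++ (x ▸ X +ᵥ y ▸ Q)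
  ++-▸-blk P X Q x y i = trans (take++drop ((x ++ y) ▸ blk P X Q) i) (++-cong _ _ top bottom i)
    where
    top : take m ((x ++ y) ▸ blk P X Q) ≗ x ▸ P
    top j = trans (take-▸-blk P X Q (x ++ y) j) (▸-congˡ P (lookup-++ˡ x y) j)
    bottom : drop m ((x ++ y) ▸ blk P X Q) ≗ x ▸ X +ᵥ y ▸ Q
    bottom j = trans (drop-▸-blk P X Q (x ++ y) j)
                     (cong₂ _+_ (▸-congˡ X (lookup-++ˡ x y) j) (▸-congˡ Q (lookup-++ʳ x y) j))

  dot-split : (z w : Row (m ℕ.+ n)) →
              dot z w ≡ dot (take m z) (take m w) + dot (drop m z) (drop m w)
  dot-split z w = ∑-split m _

  toℕ-inj₁ : ∀ {x : Fin (m ℕ.+ n)} {i} → splitAt m x ≡ inj₁ i → toℕ x ≡ toℕ i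
  toℕ-inj₁ {i = i} e = trans (cong toℕ (sym (FinP.splitAt⁻¹-↑ˡ e))) (FinP.toℕ-↑ˡ i n)

  toℕ-inj₂ : ∀ {x : Fin (m ℕ.+ n)} {j} → splitAt m x ≡ inj₂ j → toℕ x ≡ m ℕ.+ toℕ j
  toℕ-inj₂ {j = j} e = trans (cong toℕ (sym (FinP.splitAt⁻¹-↑ʳ e))) (FinP.toℕ-↑ʳ m j)

  blk-UT : ∀ P X Q → UpperTriangular P → UpperTriangular Q → UpperTriangular (blk P X Q)
  blk-UT P X Q uP uQ x y y<x with splitAt m x in ex
  ... | inj₂ i = bottom-row (splitAt m y) refl
    where
    bottom-row : ∀ s → splitAt m y ≡ s → Sum.[ 0ᵥ , Q i ] s ≡ + 0
    bottom-row (inj₁ j) _  = refl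
    bottom-row (inj₂ j) ey =
      uQ i j (ℕP.+-cancelˡ-< m _ _ (subst₂ ℕ._<_ (toℕ-inj₂ ey) (toℕ-inj₂ ex) y<x))
  ... | inj₁ i = top-row (splitAt m y) refl
    where
    top-row : ∀ s → splitAt m y ≡ s → Sum.[ P i , X i ] s ≡ + 0
    top-row (inj₁ j) ey = uP i j (subst₂ ℕ._<_ (toℕ-inj₁ ey) (toℕ-inj₁ ex) y<x)
    top-row (inj₂ j) ey = ⊥-elim (ℕP.<-asym y<x
      (subst₂ ℕ._<_ (sym (toℕ-inj₁ ex)) (sym (toℕ-inj₂ ey))
              (ℕP.<-≤-trans (FinP.toℕ<n i) (ℕP.m≤m+n m (toℕ j)))))

  zero-top-▸-blk : ∀ P X Q (y : Row n) → (0ᵥ ++ y) ▸ blk P X Q ≗ 0ᵥ ++ (y ▸ Q)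
  zero-top-▸-blk P X Q y i = trans (++-▸-blk P X Q (0ᵥ {m}) y i) (++-cong _ _ (▸-zeroˡ P) bottom i)
    where
    bottom : 0ᵥ ▸ X +ᵥ y ▸ Q ≗ y ▸ Q
    bottom j = trans (cong (_+ (y ▸ Q) j) (▸-zeroˡ X j)) (ℤP.+-identityˡ _)

  dot-zero-top : (z : Row n) (w : Row (m ℕ.+ n)) → dot (0ᵥ ++ z) w ≡ dot z (drop m w)
  dot-zero-top z w = begin
    dot (0ᵥ ++ z) w
      ≡⟨ dot-split (0ᵥ ++ z) w ⟩
    dot (take m (0ᵥ ++ z)) (take m w) + dot (drop m (0ᵥ ++ z)) (drop m w)
      ≡⟨ cong₂ _+_ (trans (dot-cong {y = take m w} (lookup-++ˡ (0ᵥ {m}) z) (λ _ → refl))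
                          (∑-zero (λ i → ℤP.*-zeroˡ (w (i ↑ˡ n)))))
                   (dot-cong {y = drop m w} (lookup-++ʳ (0ᵥ {m}) z) (λ _ → refl)) ⟩
    + 0 + dot z (drop m w)
      ≡⟨ ℤP.+-identityˡ _ ⟩
    dot z (drop m w)
      ∎

-- Kronecker products, indexed by Fin (m * n) ≅ Fin m × Fin n.

module _ {m n : ℕ} where

  quot : Fin (m ℕ.* n) → Fin m
  quot = quotient n

  rem : Fin (m ℕ.* n) → Fin n
  rem = remainder {m} n

  infixl 7 _⊗ᵥ_ _⊠_
  _⊗ᵥ_ : Row m → Row n → Row (m ℕ.* n)
  (x ⊗ᵥ y) w = x (quot w) * y (rem w)

  _⊠_ : Mat m → Mat n → Mat (m ℕ.* n)
  (A ⊠ B) w w' = A (quot w) (quot w') * B (rem w) (rem w')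

  ⊗ᵥ-cong : ∀ {x x' : Row m} {y y' : Row n} → x ≗ x' → y ≗ y' → x ⊗ᵥ y ≗ x' ⊗ᵥ y'
  ⊗ᵥ-cong ex ey w = cong₂ _*_ (ex (quot w)) (ey (rem w))

  dot-⊗ᵥ : (x x' : Row m) (y y' : Row n) → dot (x ⊗ᵥ y) (x' ⊗ᵥ y') ≡ dot x x' * dot y y'
  dot-⊗ᵥ x x' y y' = begin
    ∑ (λ w → x (quot w) * y (rem w) * (x' (quot w) * y' (rem w)))
      ≡⟨ ∑-remQuot m n (λ (i , j) → x i * y j * (x' i * y' j)) ⟩
    ∑ (λ i → ∑ (λ j → x i * y j * (x' i * y' j)))
      ≡⟨ ∑-cong (λ i → ∑-cong (λ j → interchange (x i) (y j) (x' i) (y' j))) ⟩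
    ∑ (λ i → ∑ (λ j → x i * x' i * (y j * y' j)))
      ≡⟨ ∑-product (λ i → x i * x' i) (λ j → y j * y' j) ⟩
    dot x x' * dot y y'
      ∎
    where
    interchange : ∀ a b c d → a * b * (c * d) ≡ a * c * (b * d)
    interchange = solve-∀

  -- Column w' of A ⊠ B is the tensor of the columns, so the action of a
  -- Kronecker product on a tensor is the tensor of the actions.
  ⊗ᵥ-▸-⊠ : (x : Row m) (y : Row n) (A : Mat m) (B : Mat n) →
           x ⊗ᵥ y ▸ A ⊠ B ≗ (x ▸ A) ⊗ᵥ (y ▸ B)
  ⊗ᵥ-▸-⊠ x y A B w' = dot-⊗ᵥ x (λ i → A i (quot w')) y (λ j → B j (rem w'))

  toℕ-quot-rem : ∀ w → toℕ w ≡ n ℕ.* toℕ (quot w) ℕ.+ toℕ (rem w)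
  toℕ-quot-rem w = trans (cong toℕ (sym (FinP.combine-remQuot {m} n w)))
                         (FinP.toℕ-combine (quot w) (rem w))

  -- Index order on Fin (m * n) refines the lexicographic order, so ⊠
  -- preserves upper triangularity.
  ⊠-UT : (A : Mat m) (B : Mat n) → UpperTriangular A → UpperTriangular B → UpperTriangular (A ⊠ B)
  ⊠-UT A B uA uB w w' w'<w with toℕ (quot w') ℕ.<? toℕ (quot w) | toℕ (rem w') ℕ.<? toℕ (rem w)
  ... | yes q'<q | _        = trans (cong (_* b) (uA (quot w) (quot w') q'<q)) (ℤP.*-zeroˡ b)
    where b : ℤ
          b = B (rem w) (rem w')
  ... | no _     | yes r'<r = trans (cong (a *_) (uB (rem w) (rem w') r'<r)) (ℤP.*-zeroʳ a)
    where a : ℤ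
          a = A (quot w) (quot w')
  ... | no q'≮q  | no r'≮r  = ⊥-elim (ℕP.<⇒≱ w'<w
    (subst₂ ℕ._≤_ (sym (toℕ-quot-rem w)) (sym (toℕ-quot-rem w'))
            (ℕP.+-mono-≤ (ℕP.*-monoʳ-≤ n (ℕP.≮⇒≥ q'≮q)) (ℕP.≮⇒≥ r'≮r))))

module _ {m n : ℕ} (M₁ N₁ : Mat m) (M₂ N₂ : Mat n) where

  diag-M diag-N : Mat (m ℕ.+ n)
  diag-M = blk M₁ 0ₘ M₂
  diag-N = blk N₁ 0ₘ N₂

  diag-top : Simulation diag-M diag-N M₁ N₁
  diag-top = record { φ = take m ; φ-cong = λ e j → e (j ↑ˡ n)
                    ; φ-M = take-▸-blk M₁ 0ₘ M₂ ; φ-N = take-▸-blk N₁ 0ₘ N₂ }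

  diag-bottom : Simulation diag-M diag-N M₂ N₂
  diag-bottom = record { φ = drop m ; φ-cong = λ e j → e (m ↑ʳ j)
                       ; φ-M = drop-▸-diag M₁ M₂ ; φ-N = drop-▸-diag N₁ N₂ }

  diag-word-top : ∀ {t} (a : Vec ℕ (suc t)) (x : Row m) (y : Row n) →
                  take m ((x ++ y) ▸ word diag-M diag-N a) ≗ x ▸ word M₁ N₁ a
  diag-word-top a x y j =
    trans (simulate diag-top a (x ++ y) j) (▸-congˡ (word M₁ N₁ a) (lookup-++ˡ x y) j)

  diag-word-bottom : ∀ {t} (a : Vec ℕ (suc t)) (x : Row m) (y : Row n) →
                     drop m ((x ++ y) ▸ word diag-M diag-N a) ≗ y ▸ word M₂ N₂ a
  diag-word-bottom a x y j =
    trans (simulate diag-bottom a (x ++ y) j) (▸-congˡ (word M₂ N₂ a) (lookup-++ʳ x y) j)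

  diag-tensor : Simulation diag-M diag-N (M₁ ⊠ M₂) (N₁ ⊠ N₂)
  diag-tensor = record
    { φ      = λ z → take m z ⊗ᵥ drop m z
    ; φ-cong = λ e → ⊗ᵥ-cong (λ j → e (j ↑ˡ n)) (λ j → e (m ↑ʳ j))
    ; φ-M    = λ z w → trans (⊗ᵥ-cong (take-▸-blk M₁ 0ₘ M₂ z) (drop-▸-diag M₁ M₂ z) w)
                             (sym (⊗ᵥ-▸-⊠ (take m z) (drop m z) M₁ M₂ w))
    ; φ-N    = λ z w → trans (⊗ᵥ-cong (take-▸-blk N₁ 0ₘ N₂ z) (drop-▸-diag N₁ N₂ z) w)
                             (sym (⊗ᵥ-▸-⊠ (take m z) (drop m z) N₁ N₂ w)) }

  ⊠-word : ∀ {t} (a : Vec ℕ (suc t)) (x : Row m) (y : Row n) →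
           x ⊗ᵥ y ▸ word (M₁ ⊠ M₂) (N₁ ⊠ N₂) a
             ≗ (x ▸ word M₁ N₁ a) ⊗ᵥ (y ▸ word M₂ N₂ a)
  ⊠-word a x y w = begin
    (x ⊗ᵥ y ▸ W⊠) w
      ≡⟨ ▸-congˡ W⊠ (⊗ᵥ-cong (lookup-++ˡ x y) (lookup-++ʳ x y)) w ⟨
    (take m (x ++ y) ⊗ᵥ drop m (x ++ y) ▸ W⊠) w
      ≡⟨ simulate diag-tensor a (x ++ y) w ⟨
    (take m ((x ++ y) ▸ W) ⊗ᵥ drop m ((x ++ y) ▸ W)) w
      ≡⟨ ⊗ᵥ-cong (diag-word-top a x y) (diag-word-bottom a x y) w ⟩
    ((x ▸ word M₁ N₁ a) ⊗ᵥ (y ▸ word M₂ N₂ a)) w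
      ∎
    where
    W : Mat (m ℕ.+ n)
    W = word diag-M diag-N a
    W⊠ : Mat (m ℕ.* n)
    W⊠ = word (M₁ ⊠ M₂) (N₁ ⊠ N₂) a

record Representation (t : ℕ) (f : Vec ℕ (suc t) → ℤ) : Set where
  field
    dim   : ℕ
    dim>0 : 0 ℕ.< dim
    M N   : Mat dim
    M-UT  : UpperTriangular M
    N-UT  : UpperTriangular N
    u v   : Row dim
    spec  : ∀ a → dot (u ▸ word M N a) v ≡ f a
open Representation

rep-ext : ∀ {t f g} → Representation t f → (∀ a → f a ≡ g a) → Representation t g
rep-ext r e = record { Representation r ; spec = λ a → trans (spec r a) (e a) }

rep-const : ∀ t (c : ℤ) → Representation t (λ _ → c)
rep-const t c = record
  { dim = 1 ; dim>0 = s≤s z≤n ; M = I ; N = I ; M-UT = I-UT ; N-UT = I-UT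
  ; u = λ _ → c ; v = λ _ → + 1
  ; spec = λ a → trans (dot-cong {y = λ _ → + 1} (fixed-word (λ _ → c) (▸-I _) (▸-I _) a) (λ _ → refl))
                       (c*1+0 c) }
  where
  c*1+0 : ∀ c → c * + 1 + + 0 ≡ c
  c*1+0 = solve-∀

rep-+ : ∀ {t f g} → Representation t f → Representation t g → Representation t (λ a → f a + g a)
rep-+ {f = f} {g} r s = record
  { dim = dim r ℕ.+ dim s ; dim>0 = ℕP.<-≤-trans (dim>0 r) (ℕP.m≤m+n (dim r) (dim s))
  ; M = blk (M r) 0ₘ (M s) ; N = blk (N r) 0ₘ (N s)
  ; M-UT = blk-UT (M r) 0ₘ (M s) (M-UT r) (M-UT s) ; N-UT = blk-UT (N r) 0ₘ (N s) (N-UT r) (N-UT s)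
  ; u = u r ++ u s ; v = v r ++ v s
  ; spec = spec-+ }
  where
  spec-+ : ∀ a → dot ((u r ++ u s) ▸ word (blk (M r) 0ₘ (M s)) (blk (N r) 0ₘ (N s)) a) (v r ++ v s)
                 ≡ f a + g a
  spec-+ a = begin
    dot z (v r ++ v s)
      ≡⟨ dot-split {dim r} z (v r ++ v s) ⟩
    dot (take (dim r) z) (take (dim r) (v r ++ v s)) + dot (drop (dim r) z) (drop (dim r) (v r ++ v s))
      ≡⟨ cong₂ _+_ (dot-cong (diag-word-top (M r) (N r) (M s) (N s) a (u r) (u s)) (lookup-++ˡ (v r) (v s)))
                   (dot-cong (diag-word-bottom (M r) (N r) (M s) (N s) a (u r) (u s)) (lookup-++ʳ (v r) (v s))) ⟩
    dot (u r ▸ word (M r) (N r) a) (v r) + dot (u s ▸ word (M s) (N s) a) (v s)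
      ≡⟨ cong₂ _+_ (spec r a) (spec s a) ⟩
    f a + g a
      ∎
    where
    z : Row (dim r ℕ.+ dim s)
    z = (u r ++ u s) ▸ word (blk (M r) 0ₘ (M s)) (blk (N r) 0ₘ (N s)) a

rep-* : ∀ {t f g} → Representation t f → Representation t g → Representation t (λ a → f a * g a)
rep-* {f = f} {g} r s = record
  { dim = dim r ℕ.* dim s ; dim>0 = ℕP.*-mono-< (dim>0 r) (dim>0 s)
  ; M = M r ⊠ M s ; N = N r ⊠ N s
  ; M-UT = ⊠-UT (M r) (M s) (M-UT r) (M-UT s) ; N-UT = ⊠-UT (N r) (N s) (N-UT r) (N-UT s)
  ; u = u r ⊗ᵥ u s ; v = v r ⊗ᵥ v s
  ; spec = λ a → begin
      dot (u r ⊗ᵥ u s ▸ word (M r ⊠ M s) (N r ⊠ N s) a) (v r ⊗ᵥ v s)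
        ≡⟨ dot-cong (⊠-word (M r) (N r) (M s) (N s) a (u r) (u s)) (λ _ → refl) ⟩
      dot ((u r ▸ word (M r) (N r) a) ⊗ᵥ (u s ▸ word (M s) (N s) a)) (v r ⊗ᵥ v s)
        ≡⟨ dot-⊗ᵥ (u r ▸ word (M r) (N r) a) (v r) (u s ▸ word (M s) (N s) a) (v s) ⟩
      dot (u r ▸ word (M r) (N r) a) (v r) * dot (u s ▸ word (M s) (N s) a) (v s)
        ≡⟨ cong₂ _*_ (spec r a) (spec s a) ⟩
      f a * g a
        ∎ }

-- The first coordinate a₀: the counter  C = (1 1; 0 1)  adds the first
-- entry to the second, and the reset  R = (0 0; 0 1)  clears the first
-- entry, after which everything fixes the vector.  So (1, 0) ends up
-- with a₀ in its second entry.

pattern f0 = Fin.zero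
pattern f1 = Fin.suc Fin.zero

pair : ℤ → ℤ → Row 2
pair s y f0 = s
pair s y f1 = y

counter reset : Mat 2
counter f0 f0 = + 1
counter f0 f1 = + 1
counter f1 f0 = + 0
counter f1 f1 = + 1
reset f0 f0 = + 0
reset f0 f1 = + 0
reset f1 f0 = + 0
reset f1 f1 = + 1

UT₂ : (A : Mat 2) → A f1 f0 ≡ + 0 → UpperTriangular A
UT₂ A e f0 f0 ()
UT₂ A e f0 f1 ()
UT₂ A e f1 f0 _ = e
UT₂ A e f1 f1 (s≤s ())

counter-adds : ∀ s y → pair s y ▸ counter ≗ pair s (s + y)
counter-adds s y f0 = first s y
  where first : ∀ s y → s * + 1 + (y * + 0 + + 0) ≡ s
        first = solve-∀
counter-adds s y f1 = second s y
  where second : ∀ s y → s * + 1 + (y * + 1 + + 0) ≡ s + y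
        second = solve-∀

counter-fixes : ∀ y → pair (+ 0) y ▸ counter ≗ pair (+ 0) y
counter-fixes y j = trans (counter-adds (+ 0) y j) (cong (λ z → pair (+ 0) z j) (ℤP.+-identityˡ y))

reset-clears : ∀ s y → pair s y ▸ reset ≗ pair (+ 0) y
reset-clears s y f0 = first s y
  where first : ∀ s y → s * + 0 + (y * + 0 + + 0) ≡ + 0
        first = solve-∀
reset-clears s y f1 = second s y
  where second : ∀ s y → s * + 0 + (y * + 1 + + 0) ≡ y
        second = solve-∀

counter-pow : ∀ a y → pair (+ 1) y ▸ counter ^ a ≗ pair (+ 1) (+ a + y)
counter-pow zero y j =
  trans (▸-I (pair (+ 1) y) j) (cong (λ z → pair (+ 1) z j) (sym (ℤP.+-identityˡ y)))
counter-pow (suc a) y j = begin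
  (pair (+ 1) y ▸ counter · counter ^ a) j        ≡⟨ ▸-assoc (pair (+ 1) y) counter (counter ^ a) j ⟩
  (pair (+ 1) y ▸ counter ▸ counter ^ a) j        ≡⟨ ▸-congˡ (counter ^ a) (counter-adds (+ 1) y) j ⟩
  (pair (+ 1) (+ 1 + y) ▸ counter ^ a) j          ≡⟨ counter-pow a (+ 1 + y) j ⟩
  pair (+ 1) (+ a + (+ 1 + y)) j                  ≡⟨ cong (λ z → pair (+ 1) z j) (shuffle (+ a) y) ⟩
  pair (+ 1) (+ suc a + y) j                      ∎
  where shuffle : ∀ a y → a + (+ 1 + y) ≡ + 1 + a + y
        shuffle = solve-∀

counter-word : ∀ {t} a (as : Vec ℕ t) → (pair (+ 1) (+ 0) ▸ word counter reset (a ∷ as)) f1 ≡ + a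
counter-word a [] = trans (counter-pow a (+ 0) f1) (ℤP.+-identityʳ (+ a))
counter-word a (b ∷ as) = begin
  (e ▸ word counter reset (a ∷ b ∷ as)) f1   ≡⟨ ▸-word-step counter reset a b as e f1 ⟩
  (e ▸ counter ^ a ▸ reset ▸ W) f1           ≡⟨ ▸-congˡ W counted f1 ⟩
  (pair (+ 0) (+ a + + 0) ▸ W) f1             ≡⟨ fixed-word _ (counter-fixes _) (reset-clears (+ 0) _)
                                                             (b ∷ as) f1 ⟩
  + a + + 0                                   ≡⟨ ℤP.+-identityʳ (+ a) ⟩
  + a                                         ∎
  where
  e : Row 2
  e = pair (+ 1) (+ 0)
  W : Mat 2
  W = word counter reset (b ∷ as)
  counted : e ▸ counter ^ a ▸ reset ≗ pair (+ 0) (+ a + + 0)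
  counted l = trans (▸-congˡ reset (counter-pow a (+ 0)) l) (reset-clears (+ 1) (+ a + + 0) l)

rep-first : ∀ t → Representation t (λ a → + lookup a Fin.zero)
rep-first t = record
  { dim = 2 ; dim>0 = s≤s z≤n ; M = counter ; N = reset
  ; M-UT = UT₂ counter refl ; N-UT = UT₂ reset refl
  ; u = pair (+ 1) (+ 0) ; v = pair (+ 0) (+ 1)
  ; spec = λ { (a ∷ as) → trans (read-second (pair (+ 1) (+ 0) ▸ word counter reset (a ∷ as)))
                                 (counter-word a as) } }
  where
  read-second : ∀ x → dot x (pair (+ 0) (+ 1)) ≡ x f1
  read-second x = second (x f0) (x f1)
    where second : ∀ p q → p * + 0 + (q * + 1 + + 0) ≡ q
          second = solve-∀

-- Dropping the first coordinate: with M' = (1 0; 0 M) and N' = (0 uᵀ; 0 N)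
-- the vector (1, 0) is fixed by M'^{a₀}, becomes (0, u) after the first
-- N', and from then on the lower block simulates (M, N).

fixed-pow : ∀ {k} {M : Mat k} (x : Row k) → x ▸ M ≗ x → ∀ a → x ▸ M ^ a ≗ x
fixed-pow x fix a = fixed-word x fix fix (a ∷ [])

lower-block : ∀ {m n} (P P' : Mat m) (X X' : Rect m n) (Q Q' : Mat n) →
              Simulation Q Q' (blk P X Q) (blk P' X' Q')
lower-block P P' X X' Q Q' = record
  { φ = 0ᵥ ++_ ; φ-cong = ++-cong 0ᵥ 0ᵥ (λ _ → refl)
  ; φ-M = λ y i → sym (zero-top-▸-blk P X Q y i)
  ; φ-N = λ y i → sym (zero-top-▸-blk P' X' Q' y i) }

1ᵥ : Row 1
1ᵥ _ = + 1

rep-shift : ∀ {t f} → Representation t f → Representation (suc t) (f ∘ tail)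
rep-shift {t} {f} r = record
  { dim = 1 ℕ.+ dim r ; dim>0 = s≤s z≤n ; M = M' ; N = N'
  ; M-UT = blk-UT I 0ₘ (M r) I-UT (M-UT r) ; N-UT = blk-UT 0ₘ U (N r) (λ _ _ _ → refl) (N-UT r)
  ; u = start ; v = lift (v r)
  ; spec = spec-shift }
  where
  U : Rect 1 (dim r)
  U _ = u r

  M' N' : Mat (1 ℕ.+ dim r)
  M' = blk I 0ₘ (M r)
  N' = blk 0ₘ U (N r)

  start : Row (1 ℕ.+ dim r)
  start = 1ᵥ ++ 0ᵥ

  lift : Row (dim r) → Row (1 ℕ.+ dim r)
  lift y = 0ᵥ ++ y

  start-fixed : start ▸ M' ≗ start
  start-fixed i = trans (++-▸-blk I 0ₘ (M r) 1ᵥ 0ᵥ i)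
    (++-cong _ _ (▸-I 1ᵥ) (λ j → cong₂ _+_ (▸-zeroʳ 1ᵥ j) (▸-zeroˡ (M r) j)) i)

  first-N : start ▸ N' ≗ lift (u r)
  first-N i = trans (++-▸-blk 0ₘ U (N r) 1ᵥ 0ᵥ i) (++-cong _ _ (▸-zeroʳ 1ᵥ) copy-u i)
    where
    read : ∀ x → + 1 * x + + 0 + + 0 ≡ x
    read = solve-∀
    copy-u : 1ᵥ ▸ U +ᵥ 0ᵥ ▸ N r ≗ u r
    copy-u j = trans (cong (_+_ ((1ᵥ ▸ U) j)) (▸-zeroˡ (N r) j)) (read (u r j))

  shifted-word : ∀ a b as →
                 start ▸ word M' N' (a ∷ b ∷ as) ≗ lift (u r ▸ word (M r) (N r) (b ∷ as))
  shifted-word a b as i = begin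
    (start ▸ word M' N' (a ∷ b ∷ as)) i      ≡⟨ ▸-word-step M' N' a b as start i ⟩
    (start ▸ M' ^ a ▸ N' ▸ W') i             ≡⟨ ▸-congˡ W' after-first-N i ⟩
    (lift (u r) ▸ W') i                      ≡⟨ simulate below (b ∷ as) (u r) i ⟨
    lift (u r ▸ word (M r) (N r) (b ∷ as)) i ∎
    where
    W' : Mat (1 ℕ.+ dim r)
    W' = word M' N' (b ∷ as)
    below : Simulation (M r) (N r) M' N'
    below = lower-block I 0ₘ 0ₘ U (M r) (N r)
    after-first-N : start ▸ M' ^ a ▸ N' ≗ lift (u r)
    after-first-N l = trans (▸-congˡ N' (fixed-pow {M = M'} start start-fixed a) l) (first-N l)

  spec-shift : ∀ a → dot (start ▸ word M' N' a) (lift (v r)) ≡ f (tail a)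
  spec-shift (a ∷ b ∷ as) = begin
    dot (start ▸ word M' N' (a ∷ b ∷ as)) (lift (v r))
      ≡⟨ dot-cong {y = lift (v r)} (shifted-word a b as) (λ _ → refl) ⟩
    dot (lift (u r ▸ W)) (lift (v r))
      ≡⟨ dot-zero-top (u r ▸ W) (lift (v r)) ⟩
    dot (u r ▸ W) (drop 1 (lift (v r)))
      ≡⟨ dot-cong {x = u r ▸ W} (λ _ → refl) (lookup-++ʳ (0ᵥ {1}) (v r)) ⟩
    dot (u r ▸ W) (v r)
      ≡⟨ spec r (b ∷ as) ⟩
    f (b ∷ as)
      ∎
    where
    W : Mat (dim r)
    W = word (M r) (N r) (b ∷ as)

rep-var : ∀ t (i : Fin (suc t)) → Representation t (λ a → + lookup a i)
rep-var t       Fin.zero    = rep-first t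
rep-var (suc t) (Fin.suc i) = rep-ext (rep-shift (rep-var t i)) (λ { (_ ∷ _) → refl })

rep-poly : ∀ t (p : Poly (suc t)) → Representation t (eval p)
rep-poly t (con c) = rep-const t c
rep-poly t (var i) = rep-var t i
rep-poly t (p ⊕ q) = rep-+ (rep-poly t p) (rep-poly t q)
rep-poly t (p ⊗ q) = rep-* (rep-poly t p) (rep-poly t q)

isFirst : ∀ {k} → Fin k → Bool
isFirst i = ⌊ toℕ i ℕ.≟ 0 ⌋

isLast : ∀ {k} → Fin k → Bool
isLast {k} j = ⌊ suc (toℕ j) ℕ.≟ k ⌋

select : Bool → ℤ → ℤ
select b z = if b then z else + 0

firstRow : ∀ {k} → Row k → Mat k
firstRow u i l = select (isFirst i) (u l)

lastColumn : ∀ {k} → Row k → Mat k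
lastColumn v l j = select (isLast j) (v l)

firstRow-UT : ∀ {k} (u : Row k) → UpperTriangular (firstRow u)
firstRow-UT u (Fin.suc i) j _ = refl

isLast-below : ∀ {k} {l j : Fin k} → toℕ j ℕ.< toℕ l → isLast j ≡ false
isLast-below {k} {l} {j} j<l with suc (toℕ j) ℕ.≟ k
... | yes 1+j≡k = ⊥-elim (ℕP.<⇒≢ (ℕP.<-≤-trans (s≤s j<l) (FinP.toℕ<n l)) 1+j≡k)
... | no  _     = refl

lastColumn-UT : ∀ {k} (v : Row k) → UpperTriangular (lastColumn v)
lastColumn-UT v l j j<l = cong (λ b → select b (v l)) (isLast-below j<l)

row-select : ∀ {k} b (u : Row k) (W : Mat k) l →
             ∑ (λ i → select b (u i) * W i l) ≡ select b ((u ▸ W) l)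
row-select true  u W l = refl
row-select false u W l = ∑-zero (λ i → ℤP.*-zeroˡ (W i l))

corner-sum : ∀ {k} b c (x y : Row k) →
             ∑ (λ l → select b (x l) * select c (y l)) ≡ dot x y * select (b ∧ c) (+ 1)
corner-sum true  true  x y = sym (ℤP.*-identityʳ (dot x y))
corner-sum true  false x y = trans (∑-zero (λ l → ℤP.*-zeroʳ (x l))) (sym (ℤP.*-zeroʳ (dot x y)))
corner-sum false c     x y = trans (∑-zero (λ l → ℤP.*-zeroˡ (select c (y l)))) (sym (ℤP.*-zeroʳ (dot x y)))

corner : ∀ {k} (u v : Row k) (W : Mat k) (i j : Fin k) →
         (firstRow u · W · lastColumn v) i j ≡ (dot (u ▸ W) v ⋆ E k) i j
corner u v W i j =
  trans (∑-cong (λ l → cong (_* lastColumn v l j) (row-select (isFirst i) u W l)))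
        (corner-sum (isFirst i) (isLast j) (u ▸ W) v)

lemma6 : (t : ℕ) → (p : Poly (suc t)) →
    Σ ℕ λ k → 0 < k × Σ (Mat k) λ A → Σ (Mat k) λ M → Σ (Mat k) λ N → Σ (Mat k) λ B →
      (UpperTriangular A × UpperTriangular M × UpperTriangular N × UpperTriangular B) ×
      ((a : Vec ℕ (suc t)) → (i j : Fin k) →
        (A · word M N a · B) i j ≡ (eval p a ⋆ E k) i j)
lemma6 t p =
  dim r , dim>0 r , firstRow (u r) , M r , N r , lastColumn (v r) ,
  (firstRow-UT (u r) , M-UT r , N-UT r , lastColumn-UT (v r)) ,
  λ a i j → trans (corner (u r) (v r) (word (M r) (N r) a) i j)
                  (cong (λ c → (c ⋆ E (dim r)) i j) (spec r a))
  where
  r : Representation t (eval p)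
  r = rep-poly t p
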